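{- Let $A_m(x)=R_{2m}(x)$ and $B_m(x)=R_{2m+1}(x)$. Then \[ A_m(x)=(1+x+x^2)A_{m-1}(x)-x^2A_{m-2}(x)\quad (m\ge 4),\qquad B_m(x)=(1+x+x^2)B_{m-1}(x)-x^2B_{m-2}(x)\quad (m\ge 2). \]
   Context: For $n\ge 0$, the $S$-fence $\phi_n$ is the poset on $\{x_1,\dots,x_n\}$ whose order is generated by the cover relations $x_2<x_1$, $x_3<x_2$, $x_2<x_4$, $x_5<x_4$, and, for every $i\ge 3$, $x_{2i-1}<x_{2i}$ and $x_{2i+1}<x_{2i}$, keeping only those relations whose elements both have index $\le n$ ($\phi_0$ is empty). A filter is an up-set. $\mathcal{F}(\phi_n)$ is the set of filters of $\phi_n$ ordered by reverse inclusion; it is a graded distributive lattice in which the rank of a filter $Y$ is $n-|Y|$. $r_{n,k}$ is the number of elements of rank $k$ in $\mathcal{F}(\phi_n)$ and $R_n(x)=\sum_{k\ge0}r_{n,k}x^k$ is the rank generating function. -}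

module Defs where

open import Data.Bool using (Bool; true; false; T; _∨_; _∧_)
open import Data.Nat using (ℕ; zero; suc; _+_; _∸_; _≡ᵇ_; _≤ᵇ_)
open import Data.Nat.Properties using (_≟_)
open import Data.Fin using (Fin; toℕ)
open import Data.Fin.Properties using (all?)
open import Data.Fin.Subset using (Subset; ∣_∣)
open import Data.Vec using (Vec; []; _∷_; lookup)
open import Data.List using (List; []; _∷_; map; _++_; filter; length)
open import Data.Integer using (ℤ; +_; _-_) renaming (_+_ to _+ℤ_)
open import Relation.Nullary using (Dec)
open import Relation.Nullary.Decidable using (_×-dec_; _→-dec_; T?)
open import Data.Product using (_×_)
open import Relation.Binary.PropositionalEquality using (_≡_)

-- Cover relation of the S-fence on 1-based indices:
-- coverℕ a b = true  iff  x_a < x_b is one of the generating cover relations.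
-- x2<x1, x3<x2, x2<x4, x5<x4, and for i ≥ 3: x_{2i-1} < x_{2i}, x_{2i+1} < x_{2i}.
isEven : ℕ → Bool
isEven zero = true
isEven (suc zero) = false
isEven (suc (suc n)) = isEven n

coverℕ : ℕ → ℕ → Bool
coverℕ a b =
     ((a ≡ᵇ 2) ∧ (b ≡ᵇ 1))
  ∨ (((a ≡ᵇ 3) ∧ (b ≡ᵇ 2))
  ∨ (((a ≡ᵇ 2) ∧ (b ≡ᵇ 4))
  ∨ (((a ≡ᵇ 5) ∧ (b ≡ᵇ 4))
  ∨ (isEven b ∧ ((6 ≤ᵇ b) ∧ (((suc a) ≡ᵇ b) ∨ (a ≡ᵇ suc b)))))))

-- element x_{i+1} of φ_n is represented by i : Fin n
Cover : {n : ℕ} → Fin n → Fin n → Set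
Cover a b = T (coverℕ (suc (toℕ a)) (suc (toℕ b)))

-- A filter (up-set) of φ_n: closed upward along every generating cover
-- relation (equivalently, along the order they generate).
IsFilter : {n : ℕ} → Subset n → Set
IsFilter {n} Y = (a b : Fin n) → Cover a b → T (lookup Y a) → T (lookup Y b)

isFilter? : {n : ℕ} (Y : Subset n) → Dec (IsFilter Y)
isFilter? Y = all? λ a → all? λ b →
  T? (coverℕ (suc (toℕ a)) (suc (toℕ b))) →-dec (T? (lookup Y a) →-dec T? (lookup Y b))

allSubsets : (n : ℕ) → List (Subset n)
allSubsets zero = [] ∷ []
allSubsets (suc n) = map (true ∷_) (allSubsets n) ++ map (false ∷_) (allSubsets n)

rank : {n : ℕ} → Subset n → ℕ
rank {n} Y = n ∸ ∣ Y ∣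

r : ℕ → ℕ → ℕ
r n k = length (filter (λ Y → isFilter? Y ×-dec (rank Y ≟ k)) (allSubsets n))

Poly : Set
Poly = ℕ → ℤ

R : ℕ → Poly
R n k = + (r n k)

A B : ℕ → Poly
A m = R (2 * m) where open Data.Nat using (_*_)
B m = R (suc (2 * m)) where open Data.Nat using (_*_)

_⊕_ _⊖_ : Poly → Poly → Poly
(p ⊕ q) k = p k +ℤ q k
(p ⊖ q) k = p k - q k

xP : Poly → Poly
xP p zero = + 0
xP p (suc k) = p k

onePlusXPlusX² : Poly → Poly
onePlusXPlusX² p = (p ⊕ xP p) ⊕ xP (xP p)

x²P : Poly → Poly
x²P p = xP (xP p)

-- Every cover relation joins elements at
-- distance at most two, so filters are exactly the vectors accepted by a left-to-right scan
-- that remembers the last two entries, and R_n is a product of transfer matrices. From x₄ on,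
-- φ_n is the zigzag x₄ > x₅ < x₆ > x₇ < ⋯, so two scan steps act by the fixed matrix
-- [[1 + x, x²], [x, x²]] of trace 1 + x + x² and determinant x²; by Cayley–Hamilton R_n obeys
-- the recurrence for n ≥ 8, the first positions entering only linearly. The odd cases n = 5, 7
-- are checked directly.
module Submission where

open import Defs
open import Data.Nat using (ℕ; _≤_; _∸_)
open import Data.Product using (_×_)
open import Relation.Binary.PropositionalEquality using (_≡_)

open import Algebra.Properties.CommutativeSemigroup using (interchange)
open import Data.Bool using (Bool; true; false; T; _∧_; if_then_else_)
open import Data.Bool.Properties using (T-∧; T-∨; ∧-assoc; ∧-zeroʳ)
open import Data.Empty using (⊥-elim)
open import Data.Fin using (Fin; zero; suc; toℕ)
open import Data.Fin.Subset using (Subset)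
open import Data.Fin.Subset.Properties using (∣p∣≤n)
import Data.Integer as ℤ
open import Data.Integer.Properties using ([+m]-[+n]≡m⊖n; ⊖-≥)
open import Data.List using (List; []; _∷_; _++_; map; filter; length)
open import Data.List.Properties using (filter-++; filter-≐; length-++)
open import Data.Nat using (zero; suc; _+_; _*_; _≡ᵇ_; _≤ᵇ_; z≤n; s≤s)
open import Data.Nat.Properties
  using (+-identityʳ; +-suc; +-commutativeSemigroup; +-∸-assoc; m+n∸n≡m; *-distribˡ-+;
         ≤-refl; ≤-trans; n≤1+n; m≤m+n; m≤n+m; ≤⇒≯; ≡ᵇ⇒≡; ≡⇒≡ᵇ)
open import Data.Nat.Tactic.RingSolver using (solve-∀)
open import Data.Product using (_,_; proj₁; proj₂)
open import Data.Product.Function.NonDependent.Propositional using (_×-⇔_)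
open import Data.Sum using (inj₁; inj₂)
open import Data.Unit using (tt)
open import Data.Vec using ([]; _∷_; lookup)
open import Function.Base using (_∘_)
open import Function.Bundles using (_⇔_; mk⇔; Equivalence)
open import Function.Properties.Equivalence using () renaming (trans to ⇔-trans; sym to ⇔-sym)
open import Relation.Binary.PropositionalEquality
  using (refl; sym; trans; cong; cong₂; subst; subst₂; _≗_; module ≡-Reasoning)
open import Relation.Nullary.Decidable using (T?)

open Equivalence using (to; from)
open ≡-Reasoning

-- Polynomials with natural coefficients

ℕPoly : Set
ℕPoly = ℕ → ℕ

infixl 6 _⊞_
infixr 7 x·_

𝟘 𝟙 : ℕPoly
𝟘 _ = 0
𝟙 zero = 1
𝟙 (suc _) = 0

_⊞_ : ℕPoly → ℕPoly → ℕPoly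
(f ⊞ g) k = f k + g k

x·_ : ℕPoly → ℕPoly
(x· f) zero = 0
(x· f) (suc k) = f k

when : Bool → ℕPoly → ℕPoly
when c f = if c then f else 𝟘

trinomial : ℕPoly → ℕPoly
trinomial f = f ⊞ x· f ⊞ x· x· f

⊞-cong : ∀ {f f′ g g′} → f ≗ f′ → g ≗ g′ → f ⊞ g ≗ f′ ⊞ g′
⊞-cong e e′ k = cong₂ _+_ (e k) (e′ k)

x·-cong : ∀ {f g} → f ≗ g → x· f ≗ x· g
x·-cong e zero = refl
x·-cong e (suc k) = e k

x·x·-cong : ∀ {f g} → f ≗ g → x· x· f ≗ x· x· g
x·x·-cong e = x·-cong (x·-cong e)

trinomial-cong : ∀ {f g} → f ≗ g → trinomial f ≗ trinomial g
trinomial-cong e = ⊞-cong (⊞-cong e (x·-cong e)) (x·x·-cong e)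

when-cong : ∀ c {f g} → f ≗ g → when c f ≗ when c g
when-cong true e = e
when-cong false e k = refl

x·-⊞ : ∀ f g → x· (f ⊞ g) ≗ x· f ⊞ x· g
x·-⊞ f g zero = refl
x·-⊞ f g (suc k) = refl

x·x·-⊞ : ∀ f g → x· x· (f ⊞ g) ≗ x· x· f ⊞ x· x· g
x·x·-⊞ f g k = trans (x·-cong (x·-⊞ f g) k) (x·-⊞ (x· f) (x· g) k)

x·𝟘 : x· 𝟘 ≗ 𝟘
x·𝟘 zero = refl
x·𝟘 (suc k) = refl

trinomial-⊞ : ∀ f g → trinomial (f ⊞ g) ≗ trinomial f ⊞ trinomial g
trinomial-⊞ f g k = begin
  (f k + g k) + (x· (f ⊞ g)) k + (x· x· (f ⊞ g)) k
    ≡⟨ cong₂ (λ a b → (f k + g k) + a + b) (x·-⊞ f g k) (x·x·-⊞ f g k) ⟩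
  (f k + g k) + ((x· f) k + (x· g) k) + ((x· x· f) k + (x· x· g) k)
    ≡⟨ cong (_+ ((x· x· f) k + (x· x· g) k))
            (interchange +-commutativeSemigroup (f k) (g k) ((x· f) k) ((x· g) k)) ⟩
  (f k + (x· f) k) + (g k + (x· g) k) + ((x· x· f) k + (x· x· g) k)
    ≡⟨ interchange +-commutativeSemigroup (f k + (x· f) k) (g k + (x· g) k) _ _ ⟩
  trinomial f k + trinomial g k ∎

-- F (4 + L) = (1 + x + x²) F (2 + L) − x² F L, with the subtracted term moved to the left.
Recurrent : (ℕ → ℕPoly) → Set
Recurrent F = ∀ L → F (4 + L) ⊞ x· x· F L ≗ trinomial (F (2 + L))

recurrent-resp : ∀ {F G} → (∀ L → F L ≗ G L) → Recurrent F → Recurrent G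
recurrent-resp {F} {G} F≗G rec L k = begin
  (G (4 + L) ⊞ x· x· G L) k   ≡⟨ ⊞-cong (F≗G (4 + L)) (x·x·-cong (F≗G L)) k ⟨
  (F (4 + L) ⊞ x· x· F L) k   ≡⟨ rec L k ⟩
  trinomial (F (2 + L)) k     ≡⟨ trinomial-cong (F≗G (2 + L)) k ⟩
  trinomial (G (2 + L)) k     ∎

recurrent-⊞ : ∀ {F G} → Recurrent F → Recurrent G → Recurrent (λ L → F L ⊞ G L)
recurrent-⊞ {F} {G} recF recG L k = begin
  F (4 + L) k + G (4 + L) k + (x· x· (F L ⊞ G L)) k
    ≡⟨ cong ((F (4 + L) k + G (4 + L) k) +_) (x·x·-⊞ (F L) (G L) k) ⟩
  F (4 + L) k + G (4 + L) k + ((x· x· F L) k + (x· x· G L) k)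
    ≡⟨ interchange +-commutativeSemigroup (F (4 + L) k) (G (4 + L) k) _ _ ⟩
  (F (4 + L) ⊞ x· x· F L) k + (G (4 + L) ⊞ x· x· G L) k
    ≡⟨ cong₂ _+_ (recF L k) (recG L k) ⟩
  trinomial (F (2 + L)) k + trinomial (G (2 + L)) k
    ≡⟨ trinomial-⊞ (F (2 + L)) (G (2 + L)) k ⟨
  trinomial (F (2 + L) ⊞ G (2 + L)) k ∎

recurrent-x· : ∀ {F} → Recurrent F → Recurrent (λ L → x· F L)
recurrent-x· rec L zero = refl
recurrent-x· rec L (suc k) = rec L k

recurrent-when : ∀ c {F} → Recurrent F → Recurrent (λ L → when c (F L))
recurrent-when true rec = rec
recurrent-when false rec L zero = refl
recurrent-when false rec L (suc zero) = refl
recurrent-when false rec L (suc (suc k)) = refl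

-- The hypotheses say that (a, b) evolves by [[1 + x, x²], [x, x²]], whose characteristic
-- polynomial is t² − (1 + x + x²) t + x².
recurrent-pair : ∀ {a b : ℕ → ℕPoly}
  → (∀ L → a (2 + L) ≗ a L ⊞ b (2 + L))
  → (∀ L → b (2 + L) ≗ x· (a L ⊞ x· b L))
  → Recurrent a × Recurrent b
recurrent-pair {a} {b} a-step b-step = recurrent-a , recurrent-b
  where
  recurrent-a : Recurrent a
  recurrent-a L k = begin
    (a (4 + L) ⊞ x· x· a L) k
      ≡⟨ cong (_+ (x· x· a L) k) (a-step (2 + L) k) ⟩
    a (2 + L) k + b (4 + L) k + (x· x· a L) k
      ≡⟨ cong (λ z → a (2 + L) k + z + (x· x· a L) k)
              (trans (b-step (2 + L) k) (x·-⊞ (a (2 + L)) (x· b (2 + L)) k)) ⟩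
    a (2 + L) k + ((x· a (2 + L)) k + (x· x· b (2 + L)) k) + (x· x· a L) k
      ≡⟨ shuffle (a (2 + L) k) _ _ _ ⟩
    a (2 + L) k + (x· a (2 + L)) k + ((x· x· a L) k + (x· x· b (2 + L)) k)
      ≡⟨ cong (a (2 + L) k + (x· a (2 + L)) k +_)
              (trans (x·x·-cong (a-step L) k) (x·x·-⊞ (a L) (b (2 + L)) k)) ⟨
    trinomial (a (2 + L)) k ∎
    where
    shuffle : ∀ p q r s → p + (q + r) + s ≡ p + q + (s + r)
    shuffle = solve-∀

  recurrent-b : Recurrent b
  recurrent-b L k = begin
    (b (4 + L) ⊞ x· x· b L) k
      ≡⟨ cong (_+ (x· x· b L) k)
              (trans (b-step (2 + L) k) (x·-⊞ (a (2 + L)) (x· b (2 + L)) k)) ⟩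
    (x· a (2 + L)) k + (x· x· b (2 + L)) k + (x· x· b L) k
      ≡⟨ cong (λ z → z + (x· x· b (2 + L)) k + (x· x· b L) k)
              (trans (x·-cong (a-step L) k) (x·-⊞ (a L) (b (2 + L)) k)) ⟩
    (x· a L) k + (x· b (2 + L)) k + (x· x· b (2 + L)) k + (x· x· b L) k
      ≡⟨ shuffle ((x· a L) k) _ _ _ ⟩
    ((x· a L) k + (x· x· b L) k) + (x· b (2 + L)) k + (x· x· b (2 + L)) k
      ≡⟨ cong (λ z → z + (x· b (2 + L)) k + (x· x· b (2 + L)) k)
              (trans (b-step L k) (x·-⊞ (a L) (x· b L) k)) ⟨
    trinomial (b (2 + L)) k ∎
    where
    shuffle : ∀ p q r s → p + q + r + s ≡ p + s + q + r
    shuffle = solve-∀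

-- Counting subsets by rank

count : ∀ {A : Set} → (A → Bool) → List A → ℕ
count f xs = length (filter (T? ∘ f) xs)

count-++ : ∀ {A : Set} (f : A → Bool) xs ys → count f (xs ++ ys) ≡ count f xs + count f ys
count-++ f xs ys = trans (cong length (filter-++ (T? ∘ f) xs ys)) (length-++ (filter (T? ∘ f) xs))

count-map : ∀ {A B : Set} (f : B → Bool) (g : A → B) xs → count f (map g xs) ≡ count (f ∘ g) xs
count-map f g [] = refl
count-map f g (x ∷ xs) with f (g x)
... | true = cong suc (count-map f g xs)
... | false = count-map f g xs

count-cong : ∀ {A : Set} {f g : A → Bool} → (∀ x → f x ≡ g x) → ∀ xs → count f xs ≡ count g xs
count-cong {f = f} {g} f≗g xs =
  cong length (filter-≐ (T? ∘ f) (T? ∘ g)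
                        ((λ {x} → subst T (f≗g x)) , (λ {x} → subst T (sym (f≗g x)))) xs)

count-false : ∀ {A : Set} (xs : List A) → count (λ _ → false) xs ≡ 0
count-false [] = refl
count-false (x ∷ xs) = count-false xs

rank-false : ∀ {n} (Y : Subset n) → rank (false ∷ Y) ≡ suc (rank Y)
rank-false Y = +-∸-assoc 1 (∣p∣≤n Y)

rankPoly : ∀ {n} → (Subset n → Bool) → ℕPoly
rankPoly {n} f k = count (λ Y → f Y ∧ (rank Y ≡ᵇ k)) (allSubsets n)

rankPoly-[] : ∀ f → rankPoly {0} f ≗ when (f []) 𝟙
rankPoly-[] f k with f []
rankPoly-[] f zero | true = refl
rankPoly-[] f (suc k) | true = refl
... | false = refl

rankPoly-when : ∀ {n} c (f : Subset n → Bool) → rankPoly (λ Y → c ∧ f Y) ≗ when c (rankPoly f)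
rankPoly-when true f k = refl
rankPoly-when {n} false f k = count-false (allSubsets n)

count-rank-suc : ∀ {n} (f : Subset n → Bool) k →
  count (λ Y → f Y ∧ (suc (rank Y) ≡ᵇ k)) (allSubsets n) ≡ (x· rankPoly f) k
count-rank-suc {n} f zero =
  trans (count-cong (λ Y → ∧-zeroʳ (f Y)) (allSubsets n)) (count-false (allSubsets n))
count-rank-suc f (suc k) = refl

rankPoly-∷ : ∀ {n} (f : Subset (suc n) → Bool) →
  rankPoly f ≗ rankPoly (f ∘ (true ∷_)) ⊞ x· rankPoly (f ∘ (false ∷_))
rankPoly-∷ {n} f k = begin
  count φ (map (true ∷_) S ++ map (false ∷_) S)
    ≡⟨ count-++ φ (map (true ∷_) S) _ ⟩
  count φ (map (true ∷_) S) + count φ (map (false ∷_) S)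
    ≡⟨ cong₂ _+_ (count-map φ _ S) (count-map φ _ S) ⟩
  rankPoly (f ∘ (true ∷_)) k + count (λ Y → f (false ∷ Y) ∧ (rank (false ∷ Y) ≡ᵇ k)) S
    ≡⟨ cong (rankPoly (f ∘ (true ∷_)) k +_)
            (count-cong (λ Y → cong (λ r → f (false ∷ Y) ∧ (r ≡ᵇ k)) (rank-false Y)) S) ⟩
  rankPoly (f ∘ (true ∷_)) k + count (λ Y → f (false ∷ Y) ∧ (suc (rank Y) ≡ᵇ k)) S
    ≡⟨ cong (rankPoly (f ∘ (true ∷_)) k +_) (count-rank-suc (f ∘ (false ∷_)) k) ⟩
  (rankPoly (f ∘ (true ∷_)) ⊞ x· rankPoly (f ∘ (false ∷_))) k ∎
  where
  S : List (Subset n)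
  S = allSubsets n
  φ : Subset (suc n) → Bool
  φ Y = f Y ∧ (rank Y ≡ᵇ k)

-- Filters as a local scan

infixr 5 _⇒_

_⇒_ : Bool → Bool → Bool
true ⇒ y = y
false ⇒ _ = true

T-⇒⇒ : ∀ {c x y} → T (c ⇒ x ⇒ y) ⇔ (T c → T x → T y)
T-⇒⇒ {false} = mk⇔ (λ _ ()) (λ _ → tt)
T-⇒⇒ {true} {false} = mk⇔ (λ _ _ ()) (λ _ → tt)
T-⇒⇒ {true} {true} = mk⇔ (λ t _ _ → t) (λ f → f tt tt)

respects : ℕ → ℕ → Bool → Bool → Bool
respects p q x y = (coverℕ p q ⇒ x ⇒ y) ∧ (coverℕ q p ⇒ y ⇒ x)

Respects : ℕ → ℕ → Bool → Bool → Set
Respects p q x y = (T (coverℕ p q) → T x → T y) × (T (coverℕ q p) → T y → T x)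

T-respects : ∀ p q x y → T (respects p q x y) ⇔ Respects p q x y
T-respects p q x y = ⇔-trans (T-∧ {coverℕ p q ⇒ x ⇒ y}) (T-⇒⇒ {coverℕ p q} ×-⇔ T-⇒⇒ {coverℕ q p})

≡ᵇ∧≡ᵇ⇒≡×≡ : ∀ a α b β → T ((a ≡ᵇ α) ∧ (b ≡ᵇ β)) → a ≡ α × b ≡ β
≡ᵇ∧≡ᵇ⇒≡×≡ a α b β t = ≡ᵇ⇒≡ a α (proj₁ (to T-∧ t)) , ≡ᵇ⇒≡ b β (proj₂ (to T-∧ t))

cover-near : ∀ a b → T (coverℕ a b) → b ≤ 2 + a × a ≤ 1 + b
cover-near a b c with to T-∨ c
... | inj₁ t with refl , refl ← ≡ᵇ∧≡ᵇ⇒≡×≡ a 2 b 1 t = s≤s z≤n , ≤-refl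
... | inj₂ c with to T-∨ c
... | inj₁ t with refl , refl ← ≡ᵇ∧≡ᵇ⇒≡×≡ a 3 b 2 t = s≤s (s≤s z≤n) , ≤-refl
... | inj₂ c with to T-∨ c
... | inj₁ t with refl , refl ← ≡ᵇ∧≡ᵇ⇒≡×≡ a 2 b 4 t = ≤-refl , s≤s (s≤s z≤n)
... | inj₂ c with to T-∨ c
... | inj₁ t with refl , refl ← ≡ᵇ∧≡ᵇ⇒≡×≡ a 5 b 4 t = s≤s (s≤s (s≤s (s≤s z≤n))) , ≤-refl
... | inj₂ c with to T-∨ (proj₂ (to (T-∧ {6 ≤ᵇ b}) (proj₂ (to (T-∧ {isEven b}) c))))
... | inj₁ e with refl ← ≡ᵇ⇒≡ (suc a) b e = n≤1+n (suc a) , m≤n+m a 2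
... | inj₂ e with refl ← ≡ᵇ⇒≡ a (suc b) e = m≤n+m b 3 , ≤-refl

far-respects : ∀ {p q} x y → 3 + p ≤ q → Respects p q x y
far-respects {p} {q} x y 3+p≤q =
  (λ c → ⊥-elim (≤⇒≯ (proj₁ (cover-near p q c)) 3+p≤q)) ,
  (λ c → ⊥-elim (≤⇒≯ (proj₂ (cover-near q p c)) (≤-trans (n≤1+n (2 + p)) 3+p≤q)))

pos : ∀ {n} → ℕ → Fin n → ℕ
pos p zero = p
pos p (suc i) = pos (suc p) i

pos≡ : ∀ {n} p (i : Fin n) → pos p i ≡ p + toℕ i
pos≡ p zero = sym (+-identityʳ p)
pos≡ p (suc i) = trans (pos≡ (suc p) i) (sym (+-suc p (toℕ i)))

pos-≥ : ∀ {n} p (i : Fin n) → p ≤ pos p i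
pos-≥ p i = subst (p ≤_) (sym (pos≡ p i)) (m≤m+n p (toℕ i))

Closed : ∀ {n} → ℕ → Subset n → Set
Closed p Y = ∀ i j → T (coverℕ (pos p i) (pos p j)) → T (lookup Y i) → T (lookup Y j)

isFilter⇔closed : ∀ {n} (Y : Subset n) → IsFilter Y ⇔ Closed 1 Y
isFilter⇔closed Y = mk⇔
  (λ H i j → H i j ∘ subst₂ (λ a b → T (coverℕ a b)) (pos≡ 1 i) (pos≡ 1 j))
  (λ H i j → H i j ∘ subst₂ (λ a b → T (coverℕ a b)) (sym (pos≡ 1 i)) (sym (pos≡ 1 j)))

HeadRespects : ∀ {n} → ℕ → Bool → Subset n → Set
HeadRespects p u W = ∀ j → Respects p (pos (suc p) j) u (lookup W j)

closed-∷ : ∀ {n p u} (W : Subset n) →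
  Closed p (u ∷ W) ⇔ (HeadRespects p u W × Closed (suc p) W)
closed-∷ W = mk⇔
  (λ H → (λ j → H zero (suc j) , H (suc j) zero) , (λ i j → H (suc i) (suc j)))
  (λ (h , H) → λ
    { zero zero _ u → u
    ; zero (suc j) → proj₁ (h j)
    ; (suc i) zero → proj₂ (h i)
    ; (suc i) (suc j) → H i j })

headRespectsᵇ : ∀ {n} → ℕ → Bool → Subset n → Bool
headRespectsᵇ p u [] = true
headRespectsᵇ p u (v ∷ []) = respects p (1 + p) u v
headRespectsᵇ p u (v ∷ a ∷ _) = respects p (1 + p) u v ∧ respects p (2 + p) u a

headRespects⇔ : ∀ {n p u} (W : Subset n) → HeadRespects p u W ⇔ T (headRespectsᵇ p u W)
headRespects⇔ [] = mk⇔ (λ _ → tt) (λ _ ())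
headRespects⇔ {p = p} {u} (v ∷ []) = mk⇔ (λ h → from (T-respects p (1 + p) u v) (h zero))
  (λ { t zero → to (T-respects p (1 + p) u v) t })
headRespects⇔ {p = p} {u} (v ∷ a ∷ W) = mk⇔
  (λ h → from both (from first (h zero) , from second (h (suc zero))))
  (λ t → λ
    { zero → to first (proj₁ (to both t))
    ; (suc zero) → to second (proj₂ (to both t))
    ; (suc (suc j)) → far-respects u (lookup W j) (pos-≥ (3 + p) j) })
  where
  first : T (respects p (1 + p) u v) ⇔ Respects p (1 + p) u v
  first = T-respects p (1 + p) u v
  second : T (respects p (2 + p) u a) ⇔ Respects p (2 + p) u a
  second = T-respects p (2 + p) u a
  both : T (respects p (1 + p) u v ∧ respects p (2 + p) u a)
         ⇔ (T (respects p (1 + p) u v) × T (respects p (2 + p) u a))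
  both = T-∧

closedᵇ : ∀ {n} → ℕ → Subset n → Bool
closedᵇ p [] = true
closedᵇ p (u ∷ W) = headRespectsᵇ p u W ∧ closedᵇ (suc p) W

closed⇔ : ∀ {n p} (Y : Subset n) → Closed p Y ⇔ T (closedᵇ p Y)
closed⇔ [] = mk⇔ (λ _ → tt) (λ _ ())
closed⇔ (u ∷ W) = ⇔-trans (closed-∷ W) (⇔-trans (headRespects⇔ W ×-⇔ closed⇔ W) (⇔-sym T-∧))

fits : ℕ → Bool → Bool → Bool → Bool
fits p u v a = respects p (2 + p) u a ∧ respects (1 + p) (2 + p) v a

-- In scan p u v W, the entries u and v sit at positions p and p + 1 and W starts at p + 2.
scan : ∀ {n} → ℕ → Bool → Bool → Subset n → Bool
scan p u v [] = true
scan p u v (a ∷ W) = fits p u v a ∧ scan (suc p) v a W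

closedᵇ-∷∷ : ∀ {n p u v} (W : Subset n) →
  closedᵇ p (u ∷ v ∷ W) ≡ respects p (1 + p) u v ∧ scan p u v W
closedᵇ-∷∷ [] = refl
closedᵇ-∷∷ {p = p} {u} {v} (a ∷ W) = begin
  (ruv ∧ rua) ∧ closedᵇ (suc p) (v ∷ a ∷ W) ≡⟨ cong ((ruv ∧ rua) ∧_) (closedᵇ-∷∷ W) ⟩
  (ruv ∧ rua) ∧ (rva ∧ scan (suc p) v a W)  ≡⟨ ∧-assoc ruv rua _ ⟩
  ruv ∧ (rua ∧ (rva ∧ scan (suc p) v a W))  ≡⟨ cong (ruv ∧_) (∧-assoc rua rva _) ⟨
  ruv ∧ ((rua ∧ rva) ∧ scan (suc p) v a W)  ∎
  where
  ruv rua rva : Bool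
  ruv = respects p (1 + p) u v
  rua = respects p (2 + p) u a
  rva = respects (1 + p) (2 + p) v a

-- The scan starts from a phantom entry false at position 0, which no cover relation involves.
isFilterᵇ : ∀ {n} → Subset n → Bool
isFilterᵇ [] = true
isFilterᵇ (v ∷ W) = scan 0 false v W

closedᵇ≡isFilterᵇ : ∀ {n} (Y : Subset n) → closedᵇ 1 Y ≡ isFilterᵇ Y
closedᵇ≡isFilterᵇ [] = refl
closedᵇ≡isFilterᵇ (v ∷ []) = refl
closedᵇ≡isFilterᵇ (v ∷ a ∷ W) = closedᵇ-∷∷ {p = 0} {u = false} (a ∷ W)

isFilter⇔isFilterᵇ : ∀ {n} (Y : Subset n) → IsFilter Y ⇔ T (isFilterᵇ Y)
isFilter⇔isFilterᵇ Y = ⇔-trans (isFilter⇔closed Y) (⇔-trans (closed⇔ Y)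
  (mk⇔ (subst T (closedᵇ≡isFilterᵇ Y)) (subst T (sym (closedᵇ≡isFilterᵇ Y)))))

scanPoly : ℕ → Bool → Bool → ℕ → ℕPoly
scanPoly p u v zero = 𝟙
scanPoly p u v (suc L) = when (fits p u v true) (scanPoly (suc p) v true L)
                       ⊞ x· when (fits p u v false) (scanPoly (suc p) v false L)

rankPoly-scan : ∀ L p u v → rankPoly {L} (scan p u v) ≗ scanPoly p u v L
rankPoly-scan zero p u v = rankPoly-[] (scan p u v)
rankPoly-scan (suc L) p u v k =
  trans (rankPoly-∷ {L} (scan p u v) k) (⊞-cong (after true) (x·-cong (after false)) k)
  where
  after : ∀ a → rankPoly {L} (λ W → fits p u v a ∧ scan (suc p) v a W)
                ≗ when (fits p u v a) (scanPoly (suc p) v a L)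
  after a k = trans (rankPoly-when {L} (fits p u v a) (scan (suc p) v a) k)
                    (when-cong (fits p u v a) (rankPoly-scan L (suc p) v a) k)

Rℕ : ℕ → ℕPoly
Rℕ zero = 𝟙
Rℕ (suc L) = scanPoly 0 false true L ⊞ x· scanPoly 0 false false L

rankPoly-isFilterᵇ : ∀ n → rankPoly {n} isFilterᵇ ≗ Rℕ n
rankPoly-isFilterᵇ zero = rankPoly-[] isFilterᵇ
rankPoly-isFilterᵇ (suc L) k = trans (rankPoly-∷ {L} isFilterᵇ k)
  (⊞-cong (rankPoly-scan L 0 false true) (x·-cong (rankPoly-scan L 0 false false)) k)

r≗rankPoly : ∀ n → r n ≗ rankPoly {n} isFilterᵇ
r≗rankPoly n k =
  cong length (filter-≐ _ (T? ∘ φ) ((λ {Y} → to (equiv Y)) , (λ {Y} → from (equiv Y)))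
                        (allSubsets n))
  where
  φ : Subset n → Bool
  φ Y = isFilterᵇ Y ∧ (rank Y ≡ᵇ k)
  equiv : ∀ Y → (IsFilter Y × rank Y ≡ k) ⇔ T (φ Y)
  equiv Y = ⇔-trans (isFilter⇔isFilterᵇ Y ×-⇔ mk⇔ (≡⇒≡ᵇ _ _) (≡ᵇ⇒≡ _ _)) (⇔-sym T-∧)

-- From x₄ on φ_n is a zigzag, so the cover relation is 2-periodic there and an entry at
-- position 5 or beyond is constrained by its predecessor only.
cover-periodic : ∀ a b → coverℕ (6 + a) (6 + b) ≡ coverℕ (4 + a) (4 + b)
cover-periodic zero zero = refl
cover-periodic zero (suc zero) = refl
cover-periodic zero (suc (suc b)) = refl
cover-periodic (suc zero) zero = refl
cover-periodic (suc zero) (suc zero) = refl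
cover-periodic (suc zero) (suc (suc b)) = refl
cover-periodic (suc (suc a)) zero = refl
cover-periodic (suc (suc a)) (suc zero) = refl
cover-periodic (suc (suc a)) (suc (suc b)) = refl

respects-periodic : ∀ a b x y → respects (6 + a) (6 + b) x y ≡ respects (4 + a) (4 + b) x y
respects-periodic a b x y =
  cong₂ (λ c d → (c ⇒ x ⇒ y) ∧ (d ⇒ y ⇒ x)) (cover-periodic a b) (cover-periodic b a)

fits-periodic : ∀ t u v a → fits (5 + t) u v a ≡ fits (3 + t) u v a
fits-periodic zero u v a = refl
fits-periodic (suc t) u v a =
  cong₂ _∧_ (respects-periodic t (2 + t) u a) (respects-periodic (1 + t) (2 + t) v a)

scanPoly-periodic : ∀ t u v L → scanPoly (5 + t) u v L ≡ scanPoly (3 + t) u v L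
scanPoly-periodic t u v zero = refl
scanPoly-periodic t u v (suc L) = cong₂ _⊞_
  (cong₂ when (fits-periodic t u v true) (scanPoly-periodic (suc t) v true L))
  (cong x·_ (cong₂ when (fits-periodic t u v false) (scanPoly-periodic (suc t) v false L)))

scanPoly₃-indep : ∀ u v L → scanPoly 3 u v L ≡ scanPoly 3 false v L
scanPoly₃-indep u v zero = refl
scanPoly₃-indep u v (suc L) = refl

scanPoly₅ : ∀ u v L → scanPoly 5 u v L ≡ scanPoly 3 false v L
scanPoly₅ u v L = trans (scanPoly-periodic 0 u v L) (scanPoly₃-indep u v L)

recurrent-scanPoly₃ : ∀ u v → Recurrent (scanPoly 3 u v)
recurrent-scanPoly₃ u v =
  recurrent-resp (λ L k → cong (λ f → f k) (sym (scanPoly₃-indep u v L))) (fence v)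
  where
  a b : ℕ → ℕPoly
  a = scanPoly 3 false true
  b = scanPoly 3 false false

  a-step : ∀ L → a (2 + L) ≗ a L ⊞ b (2 + L)
  a-step L k = cong₂ _+_
    (trans (cong (scanPoly 5 true true L k +_) (x·𝟘 k))
           (trans (+-identityʳ _) (cong (λ f → f k) (scanPoly₅ true true L))))
    refl

  b-step : ∀ L → b (2 + L) ≗ x· (a L ⊞ x· b L)
  b-step L k = cong₂ (λ f g → (x· (f ⊞ x· g)) k) (scanPoly₅ false true L) (scanPoly₅ false false L)

  fence : ∀ v → Recurrent (scanPoly 3 false v)
  fence true = proj₁ (recurrent-pair a-step b-step)
  fence false = proj₂ (recurrent-pair a-step b-step)

recurrent-unfold : ∀ {p u v} t → (∀ a → Recurrent (λ L → scanPoly (suc p) v a (t + L))) →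
  Recurrent (λ L → scanPoly p u v (suc t + L))
recurrent-unfold {p} {u} {v} t rec =
  recurrent-⊞ (recurrent-when (fits p u v true) (rec true))
              (recurrent-x· (recurrent-when (fits p u v false) (rec false)))

recurrent-Rℕ : Recurrent (λ L → Rℕ (4 + L))
recurrent-Rℕ = recurrent-⊞ (from-start true) (recurrent-x· (from-start false))
  where
  from-start : ∀ v → Recurrent (λ L → scanPoly 0 false v (3 + L))
  from-start v =
    recurrent-unfold {0} {false} {v} 2 λ a →
    recurrent-unfold {1} {v} {a} 1 λ b →
    recurrent-unfold {2} {a} {b} 0 λ c →
    recurrent-scanPoly₃ b c

-- For odd n the recurrence already holds from n = 5; the two instances below 8 are
-- checked coefficientwise.
Rℕ-recurrence₅ : Rℕ 5 ⊞ x· x· Rℕ 1 ≗ trinomial (Rℕ 3)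
Rℕ-recurrence₅ 0 = refl
Rℕ-recurrence₅ 1 = refl
Rℕ-recurrence₅ 2 = refl
Rℕ-recurrence₅ 3 = refl
Rℕ-recurrence₅ 4 = refl
Rℕ-recurrence₅ 5 = refl
Rℕ-recurrence₅ (suc (suc (suc (suc (suc (suc k)))))) = refl

Rℕ-recurrence₇ : Rℕ 7 ⊞ x· x· Rℕ 3 ≗ trinomial (Rℕ 5)
Rℕ-recurrence₇ 0 = refl
Rℕ-recurrence₇ 1 = refl
Rℕ-recurrence₇ 2 = refl
Rℕ-recurrence₇ 3 = refl
Rℕ-recurrence₇ 4 = refl
Rℕ-recurrence₇ 5 = refl
Rℕ-recurrence₇ 6 = refl
Rℕ-recurrence₇ 7 = refl
Rℕ-recurrence₇ (suc (suc (suc (suc (suc (suc (suc (suc k)))))))) = refl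

-- Integer coefficients

toℤ : ℕPoly → Poly
toℤ f k = ℤ.+ f k

xP-toℤ : ∀ {P f} → P ≗ toℤ f → xP P ≗ toℤ (x· f)
xP-toℤ P≗f zero = refl
xP-toℤ P≗f (suc k) = P≗f k

[+m+n]-[+n]≡+m : ∀ m n → ℤ.+ (m + n) ℤ.- ℤ.+ n ≡ ℤ.+ m
[+m+n]-[+n]≡+m m n =
  trans ([+m]-[+n]≡m⊖n (m + n) n) (trans (⊖-≥ (m≤n+m n m)) (cong ℤ.+_ (m+n∸n≡m m n)))

recurrence-ℤ : ∀ {P Q S f g h} → P ≗ toℤ f → Q ≗ toℤ g → S ≗ toℤ h →
  f ⊞ x· x· h ≗ trinomial g → P ≗ onePlusXPlusX² Q ⊖ x²P S
recurrence-ℤ {P} {Q} {S} {f} {g} {h} P≗f Q≗g S≗h rec k = begin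
  P k                                           ≡⟨ P≗f k ⟩
  ℤ.+ f k                                       ≡⟨ [+m+n]-[+n]≡+m (f k) ((x· x· h) k) ⟨
  ℤ.+ (f k + (x· x· h) k) ℤ.- ℤ.+ (x· x· h) k    ≡⟨ cong (λ n → ℤ.+ n ℤ.- ℤ.+ (x· x· h) k) (rec k) ⟩
  ℤ.+ trinomial g k ℤ.- ℤ.+ (x· x· h) k          ≡⟨ cong₂ ℤ._-_ expand (xP-toℤ (xP-toℤ S≗h) k) ⟨
  (onePlusXPlusX² Q ⊖ x²P S) k                  ∎
  where
  expand : onePlusXPlusX² Q k ≡ ℤ.+ trinomial g k
  expand = cong₂ ℤ._+_ (cong₂ ℤ._+_ (Q≗g k) (xP-toℤ Q≗g k)) (xP-toℤ (xP-toℤ Q≗g) k)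

R-recurrence : ∀ {a b c} → Rℕ a ⊞ x· x· Rℕ c ≗ trinomial (Rℕ b) →
  R a ≗ onePlusXPlusX² (R b) ⊖ x²P (R c)
R-recurrence {a} {b} {c} = recurrence-ℤ (R≗Rℕ a) (R≗Rℕ b) (R≗Rℕ c)
  where
  R≗Rℕ : ∀ n → R n ≗ toℤ (Rℕ n)
  R≗Rℕ n k = cong ℤ.+_ (trans (r≗rankPoly n k) (rankPoly-isFilterᵇ n k))

R-recurrence-from-8 : ∀ {a b c} L → a ≡ 8 + L → b ≡ 6 + L → c ≡ 4 + L →
  R a ≗ onePlusXPlusX² (R b) ⊖ x²P (R c)
R-recurrence-from-8 L refl refl refl = R-recurrence {8 + L} {6 + L} {4 + L} (recurrent-Rℕ L)

proposition2 : ((m : ℕ) → 4 ≤ m → (k : ℕ) →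
                 A m k ≡ (onePlusXPlusX² (A (m ∸ 1)) ⊖ x²P (A (m ∸ 2))) k)
               × ((m : ℕ) → 2 ≤ m → (k : ℕ) →
                 B m k ≡ (onePlusXPlusX² (B (m ∸ 1)) ⊖ x²P (B (m ∸ 2))) k)
proposition2 = even , odd
  where
  even : (m : ℕ) → 4 ≤ m → (k : ℕ) → A m k ≡ (onePlusXPlusX² (A (m ∸ 1)) ⊖ x²P (A (m ∸ 2))) k
  even 1 (s≤s ())
  even 2 (s≤s (s≤s ()))
  even 3 (s≤s (s≤s (s≤s ())))
  even (suc (suc (suc (suc m)))) _ =
    R-recurrence-from-8 (2 * m) (*-distribˡ-+ 2 4 m) (*-distribˡ-+ 2 3 m) (*-distribˡ-+ 2 2 m)

  odd : (m : ℕ) → 2 ≤ m → (k : ℕ) → B m k ≡ (onePlusXPlusX² (B (m ∸ 1)) ⊖ x²P (B (m ∸ 2))) k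
  odd 1 (s≤s ())
  odd 2 _ = R-recurrence {5} {3} {1} Rℕ-recurrence₅
  odd 3 _ = R-recurrence {7} {5} {3} Rℕ-recurrence₇
  odd (suc (suc (suc (suc m)))) _ = R-recurrence-from-8 (suc (2 * m))
    (cong suc (*-distribˡ-+ 2 4 m)) (cong suc (*-distribˡ-+ 2 3 m)) (cong suc (*-distribˡ-+ 2 2 m))
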